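{- For every positive integer $n$, \[ e^n = \sum_{k=0}^{n-1} \frac{n^k}{k!} + \frac{n^{n-1}}{(n-1)!} \left( 1 + n + \mathop{\mathrm{K}}_{m=1}^{\infty} \left(\frac{ -n(m+n-1)}{m+2 n + 1}\right) \right), \] and in particular the continued fraction appearing on the right-hand side converges.
   Context: For sequences $(a_m)_{m\ge1}$ and $(b_m)_{m\ge1}$ of complex numbers, the notation $\mathop{\mathrm{K}}_{m=1}^{\infty} \left(\frac{a_m}{b_m}\right)$ stands for the continued fraction \[ \cfrac{a_1}{b_1+\cfrac{a_2}{b_2+\cfrac{a_3}{b_3+\cdots}}}. \] Its value is the limit, when it exists, of its convergents, which are the finite truncations $\mathop{\mathrm{K}}_{m=1}^{k}\left(\frac{a_m}{b_m}\right)$. -}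

module Defs where

open import Data.Nat as ℕ using (ℕ; zero; suc; _∸_; _!)
open import Data.Nat.Properties using (_!≢0)
open import Data.Integer as ℤ using (ℤ; +_)
open import Data.Rational as ℚ using (ℚ; 0ℚ; 1ℚ; _+_; _*_; _÷_; -_)
open import Data.Maybe using (Maybe; just; nothing)
open import Relation.Nullary using (yes; no)

ℕ→ℚ : ℕ → ℚ
ℕ→ℚ k = (+ k) ℚ./ 1

powDivFact : ℕ → ℕ → ℚ
powDivFact n k = (+ (n ℕ.^ k)) ℚ./ (k !)
  where instance _ = k !≢0

expPartial : ℕ → ℕ → ℚ
expPartial n zero    = 0ℚ
expPartial n (suc N) = expPartial n N + powDivFact n N

-- kFrom a b s l = K_{m=s}^{s+l-1} (a_m / b_m), the finite continued fraction
-- a_s/(b_s + a_{s+1}/(b_{s+1} + ... + a_{s+l-1}/b_{s+l-1})),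
-- evaluated from the inside out; 'nothing' if some division by zero occurs.
kFrom : (ℕ → ℚ) → (ℕ → ℚ) → ℕ → ℕ → Maybe ℚ
kFrom a b s zero = just 0ℚ
kFrom a b s (suc l) with kFrom a b (suc s) l
... | nothing = nothing
... | just t with b s + t ℚ.≟ 0ℚ
...   | yes _ = nothing
...   | no d≢0 = just ((a s ÷ (b s + t)) {{ℚ.≢-nonZero d≢0}})

convergent : (ℕ → ℚ) → (ℕ → ℚ) → ℕ → Maybe ℚ
convergent a b k = kFrom a b 1 k

cfA : ℕ → ℕ → ℚ
cfA n m = - ℕ→ℚ (n ℕ.* (m ℕ.+ n ∸ 1))

cfB : ℕ → ℕ → ℚ
cfB n m = ℕ→ℚ (m ℕ.+ 2 ℕ.* n ℕ.+ 1)

-- Right-hand side with the continued fraction replaced by the value q: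
-- Σ_{k=0}^{n-1} n^k/k! + n^{n-1}/(n-1)! * (1 + n + q)
rhs : ℕ → ℚ → ℚ
rhs n q = expPartial n n + powDivFact n (n ∸ 1) * (1ℚ + ℕ→ℚ n + q)

-- Write Eₖ = Σ_{j<k} nʲ/j!, τₖ = nᵏ/k! and let qₖ be the k-th convergent of
-- K_{m≥1} (aₘ/bₘ) with aₘ = -n(m+n-1), bₘ = m+2n+1.  The theorem says that the
-- convergents are defined and that rhs(qₖ) - Eₖ → 0, i.e. rhs(qₖ) → eⁿ.
--
-- 1. Generic continued-fraction facts, for arbitrary aₘ, bₘ: the values computed
--    by kFrom are ratios of continuants, continuants satisfy the forward
--    three-term recurrence, and a Pringsheim-type criterion makes them positive.
-- 2. Both the numerators Aₖ and the denominators Bₖ of the convergents solve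
--    the recurrence Xₖ₊₂ = bₖ₊₂Xₖ₊₁ + aₖ₊₂Xₖ.  A two-parameter family Y_{w,t} of
--    explicit solutions gives the closed forms Bₖ = (k+1)Vₖ with
--    Vₖ = (n+1)⋯(n+k), and rhs(qₖ)·Bₖ = (k+1)Vₖ E_{n+k+1} + n^{k+1}τₙ.
-- 3. Dividing by Bₖ yields the exact error formula
--    (rhs(qₖ) - E_{n+k+1})(k+1) = n τ_{n+k},
--    hence 0 ≤ rhs(qₖ) - Eₖ ≤ (n+2)τₖ for k ≥ n, and (k+1)τ_{k+1} ≤ nτₙ forces
--    this bound below any ε > 0 (Archimedean property of ℚ).

module Submission where

open import Data.Nat as ℕ using (ℕ; zero; suc; _∸_; _≤_; z≤n; s≤s; _!)
import Data.Nat.Properties as ℕₚ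
import Data.Nat.Coprimality as Coprime
import Data.Integer as ℤ
import Data.Integer.Properties as ℤₚ
open import Data.Rational as ℚ using (ℚ; mkℚ; 0ℚ; 1ℚ; _+_; _*_; -_; _-_; _÷_; ∣_∣)
open import Data.Rational.Properties
import Data.Rational.Unnormalised as ℚᵘ
import Data.Rational.Unnormalised.Properties as ℚᵘ
open import Data.Rational.Solver using (module +-*-Solver)
open +-*-Solver using (solve; _:+_; _:-_; _:*_; :-_; _:=_; con)
open import Data.Maybe using (just)
open import Data.Maybe.Properties using (just-injective)
open import Data.Product using (∃; _×_; _,_; proj₁; proj₂)
open import Data.Empty using (⊥-elim)
open import Relation.Nullary using (yes; no)
open import Relation.Binary.PropositionalEquality
open import Defs

-- ι k is k as a rational, built by iterated succession so that ι (suc k)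
-- reduces to 1ℚ + ι k; the ring solver then sees through index shifts.
ι : ℕ → ℚ
ι zero    = 0ℚ
ι (suc k) = 1ℚ + ι k

fromℚᵘ-+ : ∀ p q → ℚ.fromℚᵘ (p ℚᵘ.+ q) ≡ ℚ.fromℚᵘ p + ℚ.fromℚᵘ q
fromℚᵘ-+ p q = toℚᵘ-injective (ℚᵘ.≃-trans (toℚᵘ-fromℚᵘ (p ℚᵘ.+ q))
  (ℚᵘ.≃-sym (ℚᵘ.≃-trans (toℚᵘ-homo-+ (ℚ.fromℚᵘ p) (ℚ.fromℚᵘ q))
    (ℚᵘ.+-cong (toℚᵘ-fromℚᵘ p) (toℚᵘ-fromℚᵘ q)))))

fromℚᵘ-* : ∀ p q → ℚ.fromℚᵘ (p ℚᵘ.* q) ≡ ℚ.fromℚᵘ p * ℚ.fromℚᵘ q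
fromℚᵘ-* p q = toℚᵘ-injective (ℚᵘ.≃-trans (toℚᵘ-fromℚᵘ (p ℚᵘ.* q))
  (ℚᵘ.≃-sym (ℚᵘ.≃-trans (toℚᵘ-homo-* (ℚ.fromℚᵘ p) (ℚ.fromℚᵘ q))
    (ℚᵘ.*-cong (toℚᵘ-fromℚᵘ p) (toℚᵘ-fromℚᵘ q)))))

ℕ→ℚ-suc : ∀ k → ℕ→ℚ (suc k) ≡ 1ℚ + ℕ→ℚ k
ℕ→ℚ-suc k = trans (fromℚᵘ-cong {ℚᵘ.mkℚᵘ (ℤ.+ suc k) 0} {one ℚᵘ.+ ℚᵘ.mkℚᵘ (ℤ.+ k) 0}
                     (ℚᵘ.*≡* cross-multiplied))
                   (fromℚᵘ-+ one (ℚᵘ.mkℚᵘ (ℤ.+ k) 0))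
  where
  one = ℚᵘ.mkℚᵘ (ℤ.+ 1) 0
  cross-multiplied : ℤ.+ suc k ℤ.* ℤ.+ 1 ≡ (ℤ.+ 1 ℤ.* ℤ.+ 1 ℤ.+ ℤ.+ k ℤ.* ℤ.+ 1) ℤ.* ℤ.+ 1
  cross-multiplied = cong (ℤ._* ℤ.+ 1) (trans (ℤₚ.pos-+ 1 k)
    (cong₂ ℤ._+_ (sym (ℤₚ.*-identityʳ (ℤ.+ 1))) (sym (ℤₚ.*-identityʳ (ℤ.+ k)))))

ℕ→ℚ≡ι : ∀ k → ℕ→ℚ k ≡ ι k
ℕ→ℚ≡ι zero    = refl
ℕ→ℚ≡ι (suc k) = trans (ℕ→ℚ-suc k) (cong (1ℚ +_) (ℕ→ℚ≡ι k))

ι-+ : ∀ a b → ι (a ℕ.+ b) ≡ ι a + ι b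
ι-+ zero    b = sym (+-identityˡ (ι b))
ι-+ (suc a) b = trans (cong (1ℚ +_) (ι-+ a b)) (sym (+-assoc 1ℚ (ι a) (ι b)))

ι-* : ∀ a b → ι (a ℕ.* b) ≡ ι a * ι b
ι-* zero    b = sym (*-zeroˡ (ι b))
ι-* (suc a) b = begin
  ι (b ℕ.+ a ℕ.* b)  ≡⟨ ι-+ b (a ℕ.* b) ⟩
  ι b + ι (a ℕ.* b)  ≡⟨ cong (ι b +_) (ι-* a b) ⟩
  ι b + ι a * ι b    ≡⟨ solve 2 (λ x y → y :+ x :* y := (con 1ℚ :+ x) :* y) refl (ι a) (ι b) ⟩
  (1ℚ + ι a) * ι b   ∎
  where open ≡-Reasoning

pow : ℚ → ℕ → ℚ
pow x zero    = 1ℚ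
pow x (suc k) = x * pow x k

ι-^ : ∀ a k → ι (a ℕ.^ k) ≡ pow (ι a) k
ι-^ a zero    = refl
ι-^ a (suc k) = trans (ι-* a (a ℕ.^ k)) (cong (ι a *_) (ι-^ a k))

ι-nonNeg : ∀ k → 0ℚ ℚ.≤ ι k
ι-nonNeg zero    = ≤-refl
ι-nonNeg (suc k) = +-mono-≤ (<⇒≤ (positive⁻¹ 1ℚ)) (ι-nonNeg k)

ι-pos : ∀ {k} → 1 ≤ k → 0ℚ ℚ.< ι k
ι-pos {suc k} _ = +-mono-<-≤ (positive⁻¹ 1ℚ) (ι-nonNeg k)

ι-mono-≤ : ∀ {j k} → j ≤ k → ι j ℚ.≤ ι k
ι-mono-≤ {k = k} z≤n = ι-nonNeg k
ι-mono-≤ (s≤s j≤k)   = +-monoʳ-≤ 1ℚ (ι-mono-≤ j≤k)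

÷-*-cancel : ∀ x y .{{_ : ℚ.NonZero y}} → (x ÷ y) * y ≡ x
÷-*-cancel x y = trans (*-assoc x (ℚ.1/ y) y) (trans (cong (x *_) (*-inverseˡ y)) (*-identityʳ x))

*-÷-cancel : ∀ x y .{{_ : ℚ.NonZero y}} → (x * y) ÷ y ≡ x
*-÷-cancel x y = trans (*-assoc x y (ℚ.1/ y)) (trans (cong (x *_) (*-inverseʳ y)) (*-identityʳ x))

*-cancelʳ-≢0 : ∀ {x y} c → c ≢ 0ℚ → x * c ≡ y * c → x ≡ y
*-cancelʳ-≢0 {x} {y} c c≢0 xc≡yc =
  trans (sym (*-÷-cancel x c)) (trans (cong (λ z → z ÷ c) xc≡yc) (*-÷-cancel y c))
  where instance _ = ℚ.≢-nonZero c≢0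

pos⇒≢0 : ∀ {x} → 0ℚ ℚ.< x → x ≢ 0ℚ
pos⇒≢0 x>0 x≡0 = <-irrefl (sym x≡0) x>0

0≤-* : ∀ {x y} → 0ℚ ℚ.≤ x → 0ℚ ℚ.≤ y → 0ℚ ℚ.≤ x * y
0≤-* {x} {y} 0≤x 0≤y =
  nonNegative⁻¹ (x * y) {{nonNeg*nonNeg⇒nonNeg x {{ℚ.nonNegative 0≤x}} y {{ℚ.nonNegative 0≤y}}}}

0<-* : ∀ {x y} → 0ℚ ℚ.< x → 0ℚ ℚ.< y → 0ℚ ℚ.< x * y
0<-* {x} {y} 0<x 0<y = positive⁻¹ (x * y) {{pos*pos⇒pos x {{ℚ.positive 0<x}} y {{ℚ.positive 0<y}}}}

0≤-*-cancelˡ : ∀ {c x} → 0ℚ ℚ.< c → 0ℚ ℚ.≤ c * x → 0ℚ ℚ.≤ x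
0≤-*-cancelˡ {c} {x} 0<c 0≤cx =
  *-cancelˡ-≤-pos c {{ℚ.positive 0<c}} (subst (ℚ._≤ c * x) (sym (*-zeroʳ c)) 0≤cx)

0≤-⇒≤ : ∀ {x y} → 0ℚ ℚ.≤ y - x → x ℚ.≤ y
0≤-⇒≤ {x} {y} 0≤y-x = subst₂ ℚ._≤_ (+-identityˡ x)
  (solve 2 (λ x y → (y :- x) :+ x := y) refl x y) (+-monoˡ-≤ x 0≤y-x)

≤⇒0≤- : ∀ {x y} → x ℚ.≤ y → 0ℚ ℚ.≤ y - x
≤⇒0≤- {x} {y} x≤y = subst (ℚ._≤ y - x) (+-inverseʳ x) (+-monoˡ-≤ (- x) x≤y)

≤-+-nonNeg : ∀ {x y} → 0ℚ ℚ.≤ y → x ℚ.≤ x + y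
≤-+-nonNeg {x} {y} 0≤y = subst (ℚ._≤ x + y) (+-identityʳ x) (+-monoʳ-≤ x 0≤y)

≤-+⇒-≤ : ∀ {x y z} → x ℚ.≤ y + z → x - y ℚ.≤ z
≤-+⇒-≤ {x} {y} {z} x≤y+z =
  subst (x - y ℚ.≤_) (solve 2 (λ y z → y :+ z :- y := z) refl y z) (+-monoˡ-≤ (- y) x≤y+z)

≤⇒-≤0 : ∀ {x y} → x ℚ.≤ y → x - y ℚ.≤ 0ℚ
≤⇒-≤0 {x} {y} x≤y = subst (x - y ℚ.≤_) (+-inverseʳ y) (+-monoˡ-≤ (- y) x≤y)

-- The Archimedean property of ℚ

-- Every rational is exceeded by some natural number: m/(d+1) ≤ m < m+1.
ι-unbounded : ∀ r → ∃ λ M → r ℚ.< ι M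
ι-unbounded r@(mkℚ (ℤ.+ m) d _) =
  suc m , subst (r ℚ.<_) (trans (sym (↥p/↧p≡p m+1)) (ℕ→ℚ≡ι (suc m))) (ℚ.*<* cross-multiplied)
  where
  m+1 = mkℚ (ℤ.+ suc m) 0 (Coprime.sym (Coprime.1-coprimeTo (suc m)))
  cross-multiplied : ℤ.+ m ℤ.* ℤ.+ 1 ℤ.< ℤ.+ suc m ℤ.* ℤ.+ suc d
  cross-multiplied = subst₂ ℤ._<_ (ℤₚ.pos-* m 1) (ℤₚ.pos-* (suc m) (suc d))
    (ℤ.+<+ (ℕₚ.<-≤-trans (subst (ℕ._< suc m) (sym (ℕₚ.*-identityʳ m)) (ℕₚ.n<1+n m))
                          (ℕₚ.m≤m*n (suc m) (suc d))))
ι-unbounded (mkℚ ℤ.-[1+ _ ] _ _) = 0 , ℚ.*<* ℤ.-<+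

archimedean : ∀ c ε → 0ℚ ℚ.< ε → ∃ λ M → c ℚ.< ι M * ε
archimedean c ε ε>0 =
  M , subst (ℚ._< ι M * ε) (÷-*-cancel c ε) (*-monoˡ-<-pos ε {{ℚ.positive ε>0}} c÷ε<M)
  where
  instance _ = ℚ.≢-nonZero (pos⇒≢0 ε>0)
  M = proj₁ (ι-unbounded (c ÷ ε))
  c÷ε<M = proj₂ (ι-unbounded (c ÷ ε))

eventually-below : ∀ (x : ℕ → ℚ) c K → (∀ k → K ≤ k → x (suc k) * ι (suc k) ℚ.≤ c) →
                   ∀ ε → 0ℚ ℚ.< ε → ∃ λ M → ∀ k → M ≤ k → x k ℚ.< ε
eventually-below x c K bound ε ε>0 = suc (K ℕ.+ M₀) , below
  where
  M₀ = proj₁ (archimedean c ε ε>0)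
  below : ∀ k → suc (K ℕ.+ M₀) ≤ k → x k ℚ.< ε
  below (suc j) (s≤s K+M₀≤j) =
    *-cancelʳ-<-nonNeg (ι (suc j)) {{ℚ.nonNegative (ι-nonNeg (suc j))}} (begin-strict
    x (suc j) * ι (suc j)  ≤⟨ bound j (ℕₚ.m+n≤o⇒m≤o K K+M₀≤j) ⟩
    c                      <⟨ proj₂ (archimedean c ε ε>0) ⟩
    ι M₀ * ε               ≤⟨ *-monoʳ-≤-nonNeg ε {{ℚ.nonNegative (<⇒≤ ε>0)}}
                                (ι-mono-≤ (ℕₚ.m≤n⇒m≤1+n (ℕₚ.m+n≤o⇒n≤o K K+M₀≤j))) ⟩
    ι (suc j) * ε          ≡⟨ *-comm (ι (suc j)) ε ⟩
    ε * ι (suc j)          ∎)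
    where open ≤-Reasoning

-- Three-term recurrences

Solves : (c d X : ℕ → ℚ) → Set
Solves c d X = ∀ k → X (suc (suc k)) ≡ c k * X (suc k) + d k * X k

solutions-unique : ∀ {c d X Z} → Solves c d X → Solves c d Z →
                   X 0 ≡ Z 0 → X 1 ≡ Z 1 → ∀ k → X k ≡ Z k
solutions-unique _ _ X₀≡Z₀ _ zero = X₀≡Z₀
solutions-unique _ _ _ X₁≡Z₁ (suc zero) = X₁≡Z₁
solutions-unique {c} {d} {X} {Z} solX solZ X₀≡Z₀ X₁≡Z₁ (suc (suc k)) = begin
  X (suc (suc k))                  ≡⟨ solX k ⟩
  c k * X (suc k) + d k * X k      ≡⟨ cong₂ (λ u v → c k * u + d k * v) (same (suc k)) (same k) ⟩
  c k * Z (suc k) + d k * Z k      ≡⟨ solZ k ⟨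
  Z (suc (suc k))                  ∎
  where
  open ≡-Reasoning
  same : ∀ j → X j ≡ Z j
  same = solutions-unique {c} {d} solX solZ X₀≡Z₀ X₁≡Z₁

solutions-combine : ∀ {c d X Z} u v → Solves c d X → Solves c d Z →
                    Solves c d (λ k → u * X k + v * Z k)
solutions-combine {c} {d} {X} {Z} u v solX solZ k = begin
  u * X (suc (suc k)) + v * Z (suc (suc k))
    ≡⟨ cong₂ (λ x z → u * x + v * z) (solX k) (solZ k) ⟩
  u * (c k * X (suc k) + d k * X k) + v * (c k * Z (suc k) + d k * Z k)
    ≡⟨ solve 8 (λ u v c d X₁ X₀ Z₁ Z₀ →
         u :* (c :* X₁ :+ d :* X₀) :+ v :* (c :* Z₁ :+ d :* Z₀)
         := c :* (u :* X₁ :+ v :* Z₁) :+ d :* (u :* X₀ :+ v :* Z₀))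
         refl u v (c k) (d k) (X (suc k)) (X k) (Z (suc k)) (Z k) ⟩
  c k * (u * X (suc k) + v * Z (suc k)) + d k * (u * X k + v * Z k) ∎
  where open ≡-Reasoning

-- The inductive step of the positivity criterion below: if ρ' > 0, a ≤ 0,
-- ρ'Y ≤ X with X ≥ 0, and ρρ' ≤ bρ' + a, then ρX ≤ bX + aY.  Indeed
-- ρ'((bX + aY) - ρX) = (bρ' + a - ρρ')X + a(ρ'Y - X) is a sum of two
-- non-negative terms.
ratio-step : ∀ {ρ ρ' a b X Y} → 0ℚ ℚ.< ρ' → a ℚ.≤ 0ℚ → 0ℚ ℚ.≤ X → ρ' * Y ℚ.≤ X →
             ρ * ρ' ℚ.≤ b * ρ' + a → ρ * X ℚ.≤ b * X + a * Y
ratio-step {ρ} {ρ'} {a} {b} {X} {Y} ρ'>0 a≤0 X≥0 ρ'Y≤X ρρ'≤bρ'+a =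
  0≤-⇒≤ (0≤-*-cancelˡ ρ'>0 (subst (0ℚ ℚ.≤_) (sym rearranged) (+-mono-≤ first second)))
  where
  rearranged : ρ' * ((b * X + a * Y) - ρ * X) ≡ ((b * ρ' + a) - ρ * ρ') * X + a * (ρ' * Y - X)
  rearranged = solve 6 (λ ρ ρ' a b X Y →
      ρ' :* ((b :* X :+ a :* Y) :- ρ :* X) := ((b :* ρ' :+ a) :- ρ :* ρ') :* X :+ a :* (ρ' :* Y :- X))
    refl ρ ρ' a b X Y
  first : 0ℚ ℚ.≤ ((b * ρ' + a) - ρ * ρ') * X
  first = 0≤-* (≤⇒0≤- ρρ'≤bρ'+a) X≥0
  second : 0ℚ ℚ.≤ a * (ρ' * Y - X)
  second = nonNegative⁻¹ _ {{nonPos*nonPos⇒nonPos a {{ℚ.nonPositive a≤0}} (ρ' * Y - X)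
                              {{ℚ.nonPositive (≤⇒-≤0 ρ'Y≤X)}}}}

module ContinuedFraction (a b : ℕ → ℚ) where

  -- cont (suc l) s is the continuant of b_s, …, b_{s+l-1}, i.e. the denominator
  -- of b_s + K_{m=s+1}^{s+l-1} (aₘ/bₘ); by the usual convention the continuant of
  -- length -1 is cont 0 s = 0.
  cont : ℕ → ℕ → ℚ
  cont zero          s = 0ℚ
  cont (suc zero)    s = 1ℚ
  cont (suc (suc l)) s = b s * cont (suc l) (suc s) + a (suc s) * cont l (suc (suc s))

  -- Prepending the term a_s/b_s to a tail t = a_{s+1} cont l (s+2) / cont (l+1) (s+1).
  cont-prepend : ∀ l s t → t * cont (suc l) (suc s) ≡ a (suc s) * cont l (suc (suc s)) →
                 (b s + t) * cont (suc l) (suc s) ≡ cont (suc (suc l)) s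
  cont-prepend l s t tail-ratio =
    trans (*-distribʳ-+ (cont (suc l) (suc s)) (b s) t)
          (cong (b s * cont (suc l) (suc s) +_) tail-ratio)

  kFrom-ratio : (∀ l s → cont (suc l) s ≢ 0ℚ) → ∀ l s →
                ∃ λ t → kFrom a b s l ≡ just t × t * cont (suc l) s ≡ a s * cont l (suc s)
  kFrom-ratio cont≢0 zero s = 0ℚ , refl , trans (*-zeroˡ 1ℚ) (sym (*-zeroʳ (a s)))
  kFrom-ratio cont≢0 (suc l) s with kFrom a b (suc s) l | kFrom-ratio cont≢0 l (suc s)
  ... | .(just t) | t , refl , tail-ratio with b s + t ℚ.≟ 0ℚ
  ...   | yes b+t≡0 = ⊥-elim (cont≢0 (suc l) s (begin
      cont (suc (suc l)) s              ≡⟨ cont-prepend l s t tail-ratio ⟨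
      (b s + t) * cont (suc l) (suc s)  ≡⟨ cong (_* cont (suc l) (suc s)) b+t≡0 ⟩
      0ℚ * cont (suc l) (suc s)         ≡⟨ *-zeroˡ (cont (suc l) (suc s)) ⟩
      0ℚ                                ∎))
    where open ≡-Reasoning
  ...   | no b+t≢0 = _ , refl , (begin
      (a s ÷ (b s + t)) * cont (suc (suc l)) s
        ≡⟨ cong ((a s ÷ (b s + t)) *_) (cont-prepend l s t tail-ratio) ⟨
      (a s ÷ (b s + t)) * ((b s + t) * cont (suc l) (suc s))
        ≡⟨ *-assoc (a s ÷ (b s + t)) (b s + t) (cont (suc l) (suc s)) ⟨
      (a s ÷ (b s + t)) * (b s + t) * cont (suc l) (suc s)
        ≡⟨ cong (_* cont (suc l) (suc s)) (÷-*-cancel (a s) (b s + t)) ⟩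
      a s * cont (suc l) (suc s) ∎)
    where
    open ≡-Reasoning
    instance _ = ℚ.≢-nonZero b+t≢0

  cont-append : ∀ l s → cont (suc (suc l)) s ≡ b (s ℕ.+ l) * cont (suc l) s + a (s ℕ.+ l) * cont l s
  cont-append zero s rewrite ℕₚ.+-identityʳ s =
    cong (b s * 1ℚ +_) (trans (*-zeroʳ (a (suc s))) (sym (*-zeroʳ (a s))))
  cont-append (suc zero) s rewrite ℕₚ.+-comm s 1 =
    solve 4 (λ b₀ b₁ a₁ a₂ → b₀ :* (b₁ :* con 1ℚ :+ a₂ :* con 0ℚ) :+ a₁ :* con 1ℚ
                             := b₁ :* (b₀ :* con 1ℚ :+ a₁ :* con 0ℚ) :+ a₁ :* con 1ℚ)
      refl (b s) (b (suc s)) (a (suc s)) (a (suc (suc s)))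
  cont-append (suc (suc l)) s = begin
    b s * cont (3 ℕ.+ l) (suc s) + a (suc s) * cont (2 ℕ.+ l) (suc (suc s))
      ≡⟨ cong₂ (λ u v → b s * u + a (suc s) * v)
           (subst (λ j → cont (3 ℕ.+ l) (suc s) ≡ b j * P + a j * Q) (sym (ℕₚ.+-suc s (suc l)))
             (cont-append (suc l) (suc s)))
           (subst (λ j → cont (2 ℕ.+ l) (suc (suc s)) ≡ b j * R + a j * T)
             (trans (cong suc (sym (ℕₚ.+-suc s l))) (sym (ℕₚ.+-suc s (suc l))))
             (cont-append l (suc (suc s)))) ⟩
    b s * (bₖ * P + aₖ * Q) + a (suc s) * (bₖ * R + aₖ * T)
      ≡⟨ solve 8 (λ bs as bk ak P Q R T →
           bs :* (bk :* P :+ ak :* Q) :+ as :* (bk :* R :+ ak :* T)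
           := bk :* (bs :* P :+ as :* R) :+ ak :* (bs :* Q :+ as :* T))
           refl (b s) (a (suc s)) bₖ aₖ P Q R T ⟩
    bₖ * (b s * P + a (suc s) * R) + aₖ * (b s * Q + a (suc s) * T) ∎
    where
    open ≡-Reasoning
    bₖ = b (s ℕ.+ suc (suc l))
    aₖ = a (s ℕ.+ suc (suc l))
    P = cont (2 ℕ.+ l) (suc s)
    Q = cont (suc l) (suc s)
    R = cont (suc l) (suc (suc s))
    T = cont l (suc (suc s))

  -- Positivity criterion (of Pringsheim type): if a_{s+1} ≤ 0 and there are
  -- ρ_s > 0 with ρ_s ρ_{s+1} ≤ b_s ρ_{s+1} + a_{s+1}, then all continuants are
  -- positive, with ratios cont (l+1) s / cont l (s+1) ≥ ρ_s.
  continuants-positive : (ρ : ℕ → ℚ) → (∀ s → 0ℚ ℚ.< ρ s) → (∀ s → a (suc s) ℚ.≤ 0ℚ) →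
                         (∀ s → ρ s * ρ (suc s) ℚ.≤ b s * ρ (suc s) + a (suc s)) →
                         ∀ l s → 0ℚ ℚ.< cont (suc l) s
  continuants-positive ρ ρ>0 a≤0 ρ-bound l s = proj₁ (invariant l s)
    where
    invariant : ∀ l s → 0ℚ ℚ.< cont (suc l) s × ρ s * cont l (suc s) ℚ.≤ cont (suc l) s
    invariant zero s = positive⁻¹ 1ℚ , subst (ℚ._≤ 1ℚ) (sym (*-zeroʳ (ρ s))) (<⇒≤ (positive⁻¹ 1ℚ))
    invariant (suc l) s = <-≤-trans (0<-* (ρ>0 s) X>0) step , step
      where
      X>0 : 0ℚ ℚ.< cont (suc l) (suc s)
      X>0 = proj₁ (invariant l (suc s))
      step : ρ s * cont (suc l) (suc s) ℚ.≤ cont (suc (suc l)) s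
      step = ratio-step {ρ s} {b = b s} (ρ>0 (suc s)) (a≤0 s) (<⇒≤ X>0)
                        (proj₂ (invariant l (suc s))) (ρ-bound s)

  num den : ℕ → ℚ
  num k = a 1 * cont k 2
  den k = cont (suc k) 1

  num-solves : Solves (λ k → b (suc (suc k))) (λ k → a (suc (suc k))) num
  num-solves k = trans (cong (a 1 *_) (cont-append k 2))
    (solve 5 (λ a₁ b a X Y → a₁ :* (b :* X :+ a :* Y) := b :* (a₁ :* X) :+ a :* (a₁ :* Y))
      refl (a 1) (b (suc (suc k))) (a (suc (suc k))) (cont (suc k) 2) (cont k 2))

  den-solves : Solves (λ k → b (suc (suc k))) (λ k → a (suc (suc k))) den
  den-solves k = cont-append (suc k) 1

  convergent-defined : (∀ l s → cont (suc l) s ≢ 0ℚ) → ∀ k → ∃ λ q → convergent a b k ≡ just q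
  convergent-defined cont≢0 k with kFrom-ratio cont≢0 k 1
  ... | t , conv≡t , _ = t , conv≡t

  convergent-ratio : (∀ l s → cont (suc l) s ≢ 0ℚ) → ∀ k q →
                     convergent a b k ≡ just q → q * den k ≡ num k
  convergent-ratio cont≢0 k q conv≡q with kFrom-ratio cont≢0 k 1
  ... | t , conv≡t , ratio =
    subst (λ x → x * den k ≡ num k) (just-injective (trans (sym conv≡t) conv≡q)) ratio

-- The terms τₙ(k) = nᵏ/k! of the exponential series at n

τ-nonNeg : ∀ n k → 0ℚ ℚ.≤ powDivFact n k
τ-nonNeg n k = nonNegative⁻¹ _ {{normalize-nonNeg (n ℕ.^ k) (k !) {{k ℕₚ.!≢0}}}}

/-*-cancel : ∀ m d .{{_ : ℕ.NonZero d}} → (ℤ.+ m ℚ./ d) * ℕ→ℚ d ≡ ℕ→ℚ m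
/-*-cancel m (suc d) =
  trans (sym (fromℚᵘ-* (ℚᵘ.mkℚᵘ (ℤ.+ m) d) (ℚᵘ.mkℚᵘ (ℤ.+ suc d) 0)))
        (fromℚᵘ-cong {ℚᵘ.mkℚᵘ (ℤ.+ m) d ℚᵘ.* ℚᵘ.mkℚᵘ (ℤ.+ suc d) 0} {ℚᵘ.mkℚᵘ (ℤ.+ m) 0}
          (ℚᵘ.*≡* cross-multiplied))
  where
  cross-multiplied : (ℤ.+ m ℤ.* ℤ.+ suc d) ℤ.* ℤ.+ 1 ≡ ℤ.+ m ℤ.* ℤ.+ suc (d ℕ.* 1)
  cross-multiplied = trans (ℤₚ.*-identityʳ _) (cong (λ e → ℤ.+ m ℤ.* ℤ.+ suc e) (sym (ℕₚ.*-identityʳ d)))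

τ-times-fact : ∀ n k → powDivFact n k * ι (k !) ≡ pow (ι n) k
τ-times-fact n k = begin
  powDivFact n k * ι (k !)       ≡⟨ cong (powDivFact n k *_) (ℕ→ℚ≡ι (k !)) ⟨
  powDivFact n k * ℕ→ℚ (k !)     ≡⟨ /-*-cancel (n ℕ.^ k) (k !) {{k ℕₚ.!≢0}} ⟩
  ℕ→ℚ (n ℕ.^ k)                  ≡⟨ ℕ→ℚ≡ι (n ℕ.^ k) ⟩
  ι (n ℕ.^ k)                    ≡⟨ ι-^ n k ⟩
  pow (ι n) k                    ∎
  where open ≡-Reasoning

τ-suc : ∀ n k → powDivFact n (suc k) * ι (suc k) ≡ powDivFact n k * ι n
τ-suc n k = *-cancelʳ-≢0 (ι (k !)) (pos⇒≢0 (ι-pos (ℕₚ.1≤n! k))) (begin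
  τ (suc k) * ι (suc k) * ι (k !)    ≡⟨ *-assoc (τ (suc k)) (ι (suc k)) (ι (k !)) ⟩
  τ (suc k) * (ι (suc k) * ι (k !))  ≡⟨ cong (τ (suc k) *_) (ι-* (suc k) (k !)) ⟨
  τ (suc k) * ι (suc k !)            ≡⟨ τ-times-fact n (suc k) ⟩
  ι n * pow (ι n) k                  ≡⟨ cong (ι n *_) (τ-times-fact n k) ⟨
  ι n * (τ k * ι (k !))              ≡⟨ solve 3 (λ N t f → N :* (t :* f) := t :* N :* f) refl (ι n) (τ k) (ι (k !)) ⟩
  τ k * ι n * ι (k !)                ∎)
  where
  open ≡-Reasoning
  τ = powDivFact n

τ-pred : ∀ n → 1 ≤ n → powDivFact n (n ∸ 1) ≡ powDivFact n n
τ-pred (suc m) _ = sym (*-cancelʳ-≢0 (ι (suc m)) (pos⇒≢0 (ι-pos {suc m} (s≤s z≤n))) (τ-suc (suc m) m))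

-- The continued fraction of the theorem, for a fixed n
module Expansion (n : ℕ) where
  open ContinuedFraction (cfA n) (cfB n) public

  N : ℚ
  N = ι n

  τ : ℕ → ℚ
  τ = powDivFact n

  E : ℕ → ℚ
  E = expPartial n

  cfB-ι : ∀ m → cfB n m ≡ ι m + N + N + 1ℚ
  cfB-ι m = begin
    ℕ→ℚ (m ℕ.+ 2 ℕ.* n ℕ.+ 1)   ≡⟨ ℕ→ℚ≡ι (m ℕ.+ 2 ℕ.* n ℕ.+ 1) ⟩
    ι (m ℕ.+ 2 ℕ.* n ℕ.+ 1)     ≡⟨ ι-+ (m ℕ.+ 2 ℕ.* n) 1 ⟩
    ι (m ℕ.+ 2 ℕ.* n) + ι 1     ≡⟨ cong (_+ ι 1) (trans (ι-+ m (2 ℕ.* n)) (cong (ι m +_) (ι-* 2 n))) ⟩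
    ι m + ι 2 * N + ι 1         ≡⟨ solve 2 (λ M N → M :+ (con 1ℚ :+ (con 1ℚ :+ con 0ℚ)) :* N :+ (con 1ℚ :+ con 0ℚ)
                                            := M :+ N :+ N :+ con 1ℚ) refl (ι m) N ⟩
    ι m + N + N + 1ℚ            ∎
    where open ≡-Reasoning

  cfA-ι : ∀ m → cfA n (suc m) ≡ - (N * (ι m + N))
  cfA-ι m = cong -_ (trans (ℕ→ℚ≡ι (n ℕ.* (m ℕ.+ n))) (trans (ι-* n (m ℕ.+ n)) (cong (N *_) (ι-+ m n))))

  -- ρ_s = s + n + 1 satisfies the positivity criterion, with slack 2n.
  continuants-nonzero : ∀ l s → cont (suc l) s ≢ 0ℚ
  continuants-nonzero l s = pos⇒≢0 (continuants-positive ρ ρ>0 a≤0 ρ-bound l s)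
    where
    ρ : ℕ → ℚ
    ρ s = ι s + N + 1ℚ
    ρ>0 : ∀ s → 0ℚ ℚ.< ρ s
    ρ>0 s = +-mono-≤-< (+-mono-≤ (ι-nonNeg s) (ι-nonNeg n)) (positive⁻¹ 1ℚ)
    a≤0 : ∀ s → cfA n (suc s) ℚ.≤ 0ℚ
    a≤0 s = subst (ℚ._≤ 0ℚ) (sym (cfA-ι s))
      (neg-antimono-≤ (0≤-* (ι-nonNeg n) (+-mono-≤ (ι-nonNeg s) (ι-nonNeg n))))
    slack : ∀ s → (cfB n s * ρ (suc s) + cfA n (suc s)) - ρ s * ρ (suc s) ≡ N + N
    slack s = trans (cong₂ (λ b a → (b * ρ (suc s) + a) - ρ s * ρ (suc s)) (cfB-ι s) (cfA-ι s))
      (solve 2 (λ S N → ((S :+ N :+ N :+ con 1ℚ) :* ((con 1ℚ :+ S) :+ N :+ con 1ℚ) :+ :- (N :* (S :+ N)))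
                       :- (S :+ N :+ con 1ℚ) :* ((con 1ℚ :+ S) :+ N :+ con 1ℚ) := N :+ N) refl (ι s) N)
    ρ-bound : ∀ s → ρ s * ρ (suc s) ℚ.≤ cfB n s * ρ (suc s) + cfA n (suc s)
    ρ-bound s = 0≤-⇒≤ (subst (0ℚ ℚ.≤_) (sym (slack s)) (+-mono-≤ (ι-nonNeg n) (ι-nonNeg n)))

  b₊₂ a₊₂ : ℕ → ℚ
  b₊₂ k = cfB n (suc (suc k))
  a₊₂ k = cfA n (suc (suc k))

  SolvesCF : (ℕ → ℚ) → Set
  SolvesCF = Solves b₊₂ a₊₂

  W : ℚ → ℚ → ℕ → ℚ
  W w t zero    = w
  W w t (suc k) = (ι (suc k) + N) * W w t k + pow N (suc k) * t

  Y : ℚ → ℚ → ℕ → ℚ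
  Y w t k = ι (suc k) * W w t k + pow N (suc k) * t


  Y-solves : ∀ w t → SolvesCF (Y w t)
  Y-solves w t k = sym (trans
    (cong₂ (λ b a → b * Y w t (suc k) + a * Y w t k) (cfB-ι (suc (suc k))) (cfA-ι (suc k)))
    (solve 5 (λ K N w t P →
      let K₁ = con 1ℚ :+ K ; K₂ = con 1ℚ :+ K₁ ; K₃ = con 1ℚ :+ K₂
          W₁ = (K₁ :+ N) :* w :+ (N :* P) :* t
          W₂ = (K₂ :+ N) :* W₁ :+ (N :* (N :* P)) :* t
      in  (K₂ :+ N :+ N :+ con 1ℚ) :* (K₂ :* W₁ :+ (N :* (N :* P)) :* t)
          :+ (:- (N :* (K₁ :+ N))) :* (K₁ :* w :+ (N :* P) :* t)
          := K₃ :* W₂ :+ (N :* (N :* (N :* P))) :* t)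
      refl (ι k) N (W w t k) t (pow N k)))

  -- Vₖ = (n+1)(n+2)⋯(n+k).
  V : ℕ → ℚ
  V = W 1ℚ 0ℚ

  V-suc : ∀ k → V (suc k) ≡ (ι (suc k) + N) * V k
  V-suc k = trans (cong ((ι (suc k) + N) * V k +_) (*-zeroʳ (pow N (suc k)))) (+-identityʳ _)

  V-pos : ∀ k → 0ℚ ℚ.< V k
  V-pos zero    = positive⁻¹ 1ℚ
  V-pos (suc k) = subst (0ℚ ℚ.<_) (sym (V-suc k))
    (0<-* (+-mono-<-≤ (ι-pos {suc k} (s≤s z≤n)) (ι-nonNeg n)) (V-pos k))

  den-closed : ∀ k → den k ≡ ι (suc k) * V k
  den-closed k = begin
    den k                                         ≡⟨ solutions-unique {b₊₂} {a₊₂} {X = den} {Z = Y 1ℚ 0ℚ}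
                                                       den-solves (Y-solves 1ℚ 0ℚ) den₀ den₁ k ⟩
    ι (suc k) * V k + pow N (suc k) * 0ℚ          ≡⟨ cong (ι (suc k) * V k +_) (*-zeroʳ (pow N (suc k))) ⟩
    ι (suc k) * V k + 0ℚ                          ≡⟨ +-identityʳ _ ⟩
    ι (suc k) * V k                               ∎
    where
    open ≡-Reasoning
    den₀ : den 0 ≡ Y 1ℚ 0ℚ 0
    den₀ = solve 1 (λ N → con 1ℚ := (con 1ℚ :+ con 0ℚ) :* con 1ℚ :+ (N :* con 1ℚ) :* con 0ℚ) refl N
    den₁ : den 1 ≡ Y 1ℚ 0ℚ 1
    den₁ = trans (cong (λ b → b * 1ℚ + cfA n 2 * 0ℚ) (cfB-ι 1))
      (solve 2 (λ N a₂ → (con 1ℚ :+ con 0ℚ :+ N :+ N :+ con 1ℚ) :* con 1ℚ :+ a₂ :* con 0ℚ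
                := (con 1ℚ :+ (con 1ℚ :+ con 0ℚ)) :* (((con 1ℚ :+ con 0ℚ) :+ N) :* con 1ℚ :+ (N :* con 1ℚ) :* con 0ℚ)
                   :+ (N :* (N :* con 1ℚ)) :* con 0ℚ)
        refl N (cfA n 2))

  -- Lₖ = rhs(qₖ)·Bₖ: the numerator of the right-hand side at the k-th convergent.
  L : ℕ → ℚ
  L k = (E n + τ n * (1ℚ + N)) * den k + τ n * num k

  rhs-times-den : 1 ≤ n → ∀ k q → q * den k ≡ num k → rhs n q * den k ≡ L k
  rhs-times-den 1≤n k q q-ratio = begin
    rhs n q * den k                                          ≡⟨ cong (_* den k) rhs-ι ⟩
    (E n + τ n * (1ℚ + N + q)) * den k                       ≡⟨ solve 5 (λ e t N q B →
        (e :+ t :* (con 1ℚ :+ N :+ q)) :* B := (e :+ t :* (con 1ℚ :+ N)) :* B :+ t :* (q :* B))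
        refl (E n) (τ n) N q (den k) ⟩
    (E n + τ n * (1ℚ + N)) * den k + τ n * (q * den k)       ≡⟨ cong (λ x → (E n + τ n * (1ℚ + N)) * den k + τ n * x)
                                                                     q-ratio ⟩
    L k                                                      ∎
    where
    open ≡-Reasoning
    rhs-ι : rhs n q ≡ E n + τ n * (1ℚ + N + q)
    rhs-ι = cong₂ (λ β x → E n + β * (1ℚ + x + q)) (τ-pred n 1≤n) (ℕ→ℚ≡ι n)

  L-closed : ∀ k → L k ≡ Y (E (suc n)) (τ n) k
  L-closed = solutions-unique {b₊₂} {a₊₂} {X = L} {Z = Y (E (suc n)) (τ n)}
    (solutions-combine {b₊₂} {a₊₂} {den} {num} (E n + τ n * (1ℚ + N)) (τ n) den-solves num-solves)
    (Y-solves (E (suc n)) (τ n)) L₀ L₁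
    where
    L₀ : L 0 ≡ Y (E (suc n)) (τ n) 0
    L₀ = solve 4 (λ e t N a₁ → (e :+ t :* (con 1ℚ :+ N)) :* con 1ℚ :+ t :* (a₁ :* con 0ℚ)
                               := (con 1ℚ :+ con 0ℚ) :* (e :+ t) :+ (N :* con 1ℚ) :* t)
           refl (E n) (τ n) N (cfA n 1)
    L₁ : L 1 ≡ Y (E (suc n)) (τ n) 1
    L₁ = trans (cong₂ (λ b a → (E n + τ n * (1ℚ + N)) * (b * 1ℚ + cfA n 2 * 0ℚ) + τ n * (a * 1ℚ))
                      (cfB-ι 1) (cfA-ι 0))
      (solve 4 (λ e t N a₂ →
          (e :+ t :* (con 1ℚ :+ N)) :* ((con 1ℚ :+ con 0ℚ :+ N :+ N :+ con 1ℚ) :* con 1ℚ :+ a₂ :* con 0ℚ)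
          :+ t :* ((:- (N :* (con 0ℚ :+ N))) :* con 1ℚ)
          := (con 1ℚ :+ (con 1ℚ :+ con 0ℚ)) :* (((con 1ℚ :+ con 0ℚ) :+ N) :* (e :+ t) :+ (N :* con 1ℚ) :* t)
             :+ (N :* (N :* con 1ℚ)) :* t)
        refl (E n) (τ n) N (cfA n 2))

  V-τ : ∀ k → V k * τ (k ℕ.+ n) ≡ pow N k * τ n
  V-τ zero    = refl
  V-τ (suc k) = begin
    V (suc k) * τ (suc j)                      ≡⟨ cong (_* τ (suc j)) (V-suc k) ⟩
    (ι (suc k) + N) * V k * τ (suc j)          ≡⟨ solve 3 (λ c v t → c :* v :* t := v :* (t :* c))
                                                    refl (ι (suc k) + N) (V k) (τ (suc j)) ⟩
    V k * (τ (suc j) * (ι (suc k) + N))        ≡⟨ cong (λ x → V k * (τ (suc j) * x)) (ι-+ (suc k) n) ⟨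
    V k * (τ (suc j) * ι (suc j))              ≡⟨ cong (V k *_) (τ-suc n j) ⟩
    V k * (τ j * N)                            ≡⟨ *-assoc (V k) (τ j) N ⟨
    V k * τ j * N                              ≡⟨ cong (_* N) (V-τ k) ⟩
    pow N k * τ n * N                          ≡⟨ solve 3 (λ p t N → p :* t :* N := N :* p :* t) refl (pow N k) (τ n) N ⟩
    pow N (suc k) * τ n                        ∎
    where
    open ≡-Reasoning
    j = k ℕ.+ n

  W-closed : ∀ k → W (E (suc n)) (τ n) k ≡ V k * E (suc (k ℕ.+ n))
  W-closed zero    = sym (*-identityˡ (E (suc n)))
  W-closed (suc k) = begin
    c * W (E (suc n)) (τ n) k + pow N (suc k) * τ n   ≡⟨ cong₂ (λ w p → c * w + p)
                                                           (W-closed k) (sym (V-τ (suc k))) ⟩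
    c * (V k * F) + V (suc k) * τ (suc j)             ≡⟨ cong (λ v → c * (V k * F) + v * τ (suc j)) (V-suc k) ⟩
    c * (V k * F) + c * V k * τ (suc j)               ≡⟨ solve 4 (λ c v F t → c :* (v :* F) :+ c :* v :* t := c :* v :* (F :+ t))
                                                           refl c (V k) F (τ (suc j)) ⟩
    c * V k * (F + τ (suc j))                         ≡⟨ cong (_* (F + τ (suc j))) (V-suc k) ⟨
    V (suc k) * E (suc (suc j))                       ∎
    where
    open ≡-Reasoning
    j = k ℕ.+ n
    c = ι (suc k) + N
    F = E (suc j)

  error-identity : 1 ≤ n → ∀ k q → q * den k ≡ num k →
                   (rhs n q - E (suc (k ℕ.+ n))) * ι (suc k) ≡ N * τ (k ℕ.+ n)
  error-identity 1≤n k q q-ratio = *-cancelʳ-≢0 (V k) (pos⇒≢0 (V-pos k)) (begin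
    (R - F) * K * V k                             ≡⟨ solve 4 (λ R F K v →
                                                       (R :- F) :* K :* v := R :* (K :* v) :- K :* (v :* F))
                                                       refl R F K (V k) ⟩
    R * (K * V k) - K * (V k * F)                 ≡⟨ cong (λ d → R * d - K * (V k * F)) (den-closed k) ⟨
    R * den k - K * (V k * F)                     ≡⟨ cong (_- K * (V k * F))
                                                       (trans (rhs-times-den 1≤n k q q-ratio) (L-closed k)) ⟩
    K * W (E (suc n)) (τ n) k + N * pow N k * τ n - K * (V k * F)
                                                  ≡⟨ cong₂ (λ w p → K * w + p - K * (V k * F)) (W-closed k)
                                                       (trans (*-assoc N (pow N k) (τ n)) (cong (N *_) (sym (V-τ k)))) ⟩
    K * (V k * F) + N * (V k * τ j) - K * (V k * F)
                                                  ≡⟨ solve 5 (λ K v F N t →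
                                                       K :* (v :* F) :+ N :* (v :* t) :- K :* (v :* F) := N :* t :* v)
                                                       refl K (V k) F N (τ j) ⟩
    N * τ j * V k                                 ∎)
    where
    open ≡-Reasoning
    j = k ℕ.+ n
    R = rhs n q
    F = E (suc j)
    K = ι (suc k)

  -- From index n on the terms decrease: τ_{k+1}(k+1) = nτₖ ≤ (k+1)τₖ.
  τ-step-antitone : ∀ {k} → n ≤ k → τ (suc k) ℚ.≤ τ k
  τ-step-antitone {k} n≤k = *-cancelʳ-≤-pos (ι (suc k)) {{ℚ.positive (ι-pos {suc k} (s≤s z≤n))}}
    (subst (ℚ._≤ τ k * ι (suc k)) (sym (τ-suc n k))
      (*-monoˡ-≤-nonNeg (τ k) {{ℚ.nonNegative (τ-nonNeg n k)}} (ι-mono-≤ (ℕₚ.m≤n⇒m≤1+n n≤k))))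

  τ-antitone : ∀ {k} → n ≤ k → ∀ i → τ (i ℕ.+ k) ℚ.≤ τ k
  τ-antitone n≤k zero        = ≤-refl
  τ-antitone {k} n≤k (suc i) =
    ≤-trans (τ-step-antitone (ℕₚ.≤-trans n≤k (ℕₚ.m≤n+m k i))) (τ-antitone n≤k i)

  E-increasing : ∀ k i → E k ℚ.≤ E (i ℕ.+ k)
  E-increasing k zero    = ≤-refl
  E-increasing k (suc i) = ≤-trans (E-increasing k i) (≤-+-nonNeg (τ-nonNeg n (i ℕ.+ k)))

  E-growth : ∀ {k} → n ≤ k → ∀ i → E (i ℕ.+ k) ℚ.≤ E k + ι i * τ k
  E-growth {k} n≤k zero    =
    subst (E k ℚ.≤_) (sym (trans (cong (E k +_) (*-zeroˡ (τ k))) (+-identityʳ (E k)))) ≤-refl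
  E-growth {k} n≤k (suc i) = subst (E (suc i ℕ.+ k) ℚ.≤_)
    (solve 3 (λ e i t → e :+ i :* t :+ t := e :+ (con 1ℚ :+ i) :* t) refl (E k) (ι i) (τ k))
    (+-mono-≤ (E-growth n≤k i) (τ-antitone n≤k i))

  remainder-bounds : 1 ≤ n → ∀ {k} q → n ≤ k → q * den k ≡ num k →
                     0ℚ ℚ.≤ rhs n q - E (suc n ℕ.+ k) × rhs n q - E (suc n ℕ.+ k) ℚ.≤ τ k
  remainder-bounds 1≤n {k} q n≤k q-ratio = lower , upper
    where
    K : ℚ
    K = ι (suc k)
    instance
      K-pos : ℚ.Positive K
      K-pos = ℚ.positive (ι-pos {suc k} (s≤s z≤n))
    identity : (rhs n q - E (suc n ℕ.+ k)) * K ≡ N * τ (n ℕ.+ k)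
    identity = subst (λ j → (rhs n q - E (suc j)) * K ≡ N * τ j) (ℕₚ.+-comm k n)
                     (error-identity 1≤n k q q-ratio)
    lower : 0ℚ ℚ.≤ rhs n q - E (suc n ℕ.+ k)
    lower = *-cancelʳ-≤-pos K (subst₂ ℚ._≤_ (sym (*-zeroˡ K)) (sym identity)
                                (0≤-* (ι-nonNeg n) (τ-nonNeg n (n ℕ.+ k))))
    upper : rhs n q - E (suc n ℕ.+ k) ℚ.≤ τ k
    upper = *-cancelʳ-≤-pos K (subst (ℚ._≤ τ k * K) (sym identity) (begin
      N * τ (n ℕ.+ k)  ≤⟨ *-monoˡ-≤-nonNeg N {{ℚ.nonNegative (ι-nonNeg n)}} (τ-antitone n≤k n) ⟩
      N * τ k          ≤⟨ *-monoʳ-≤-nonNeg (τ k) {{ℚ.nonNegative (τ-nonNeg n k)}}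
                            (ι-mono-≤ (ℕₚ.m≤n⇒m≤1+n n≤k)) ⟩
      K * τ k          ≡⟨ *-comm K (τ k) ⟩
      τ k * K          ∎))
      where open ≤-Reasoning

  convergent-error : 1 ≤ n → ∀ {k} q → n ≤ k → q * den k ≡ num k →
                     0ℚ ℚ.≤ rhs n q - E k × rhs n q - E k ℚ.≤ ι (2 ℕ.+ n) * τ k
  convergent-error 1≤n {k} q n≤k q-ratio =
      subst (0ℚ ℚ.≤_) (sym split) (+-mono-≤ (≤⇒0≤- (E-increasing k (suc n))) (proj₁ remainder))
    , subst₂ ℚ._≤_ (sym split)
        (solve 2 (λ x t → x :* t :+ t := (con 1ℚ :+ x) :* t) refl (ι (suc n)) (τ k))
        (+-mono-≤ (≤-+⇒-≤ (E-growth n≤k (suc n))) (proj₂ remainder))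
    where
    R F : ℚ
    R = rhs n q
    F = E (suc n ℕ.+ k)
    remainder : 0ℚ ℚ.≤ R - F × R - F ℚ.≤ τ k
    remainder = remainder-bounds 1≤n q n≤k q-ratio
    split : R - E k ≡ (F - E k) + (R - F)
    split = solve 3 (λ R F e → R :- e := (F :- e) :+ (R :- F)) refl R F (E k)

  bound-decay : ∀ k → n ≤ k → ι (2 ℕ.+ n) * τ (suc k) * ι (suc k) ℚ.≤ ι (2 ℕ.+ n) * (τ n * N)
  bound-decay k n≤k = subst (ℚ._≤ c * (τ n * N)) (sym (*-assoc c (τ (suc k)) (ι (suc k))))
    (*-monoˡ-≤-nonNeg c {{ℚ.nonNegative (ι-nonNeg (2 ℕ.+ n))}}
      (subst (ℚ._≤ τ n * N) (sym (τ-suc n k))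
        (*-monoʳ-≤-nonNeg N {{ℚ.nonNegative (ι-nonNeg n)}} τₖ≤τₙ)))
    where
    c : ℚ
    c = ι (2 ℕ.+ n)
    τₖ≤τₙ : τ k ℚ.≤ τ n
    τₖ≤τₙ = subst (λ j → τ j ℚ.≤ τ n) (ℕₚ.m∸n+n≡m n≤k) (τ-antitone ℕₚ.≤-refl (k ∸ n))

theorem2p1 : (n : ℕ) → 1 ≤ n →
    (∃ λ N → (k : ℕ) → N ≤ k → ∃ λ q → convergent (cfA n) (cfB n) k ≡ just q)
    × ((ε : ℚ) → 0ℚ ℚ.< ε → ∃ λ M → (k : ℕ) → M ≤ k → (q : ℚ) →
        convergent (cfA n) (cfB n) k ≡ just q →
        ∣ rhs n q - expPartial n k ∣ ℚ.< ε)
theorem2p1 n 1≤n = (0 , λ k _ → convergent-defined continuants-nonzero k) , close-to-partial-sums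
  where
  open Expansion n
  close-to-partial-sums : (ε : ℚ) → 0ℚ ℚ.< ε → ∃ λ M → (k : ℕ) → M ≤ k → (q : ℚ) →
                          convergent (cfA n) (cfB n) k ≡ just q → ∣ rhs n q - E k ∣ ℚ.< ε
  close-to-partial-sums ε ε>0 = M ℕ.+ n , λ k M+n≤k q conv≡q →
    let 0≤error , error≤bound = convergent-error 1≤n q (ℕₚ.m+n≤o⇒n≤o M M+n≤k)
                                  (convergent-ratio continuants-nonzero k q conv≡q)
    in subst (ℚ._< ε) (sym (0≤p⇒∣p∣≡p 0≤error))
         (≤-<-trans error≤bound (bound<ε k (ℕₚ.m+n≤o⇒m≤o M M+n≤k)))
    where
    eventually : ∃ λ M → ∀ k → M ≤ k → ι (2 ℕ.+ n) * τ k ℚ.< ε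
    eventually = eventually-below (λ k → ι (2 ℕ.+ n) * τ k) (ι (2 ℕ.+ n) * (τ n * N)) n bound-decay ε ε>0
    M = proj₁ eventually
    bound<ε = proj₂ eventually
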